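{- For every positive integer $r$ and every graph $G$, if $G_r$ denotes the graph obtained from $G$ by subdividing every edge $r$ times (replacing each edge by a path with $r$ internal vertices), then $\mathrm{cop}(G_r)\ge \mathrm{cop}(G)$.
   Context: All graphs are finite, simple and undirected. The game of Cops and Robber on a connected graph: the cop player places $k\ge 1$ cops on vertices (not necessarily distinct), then the robber chooses a vertex; then, starting with the cops, the players alternate moves, where in the cops' move each cop either stays or moves to an adjacent vertex, and in the robber's move the robber either stays or moves to an adjacent vertex. The cops win if at some point a cop and the robber occupy the same vertex; both players have complete information. The cop number $\mathrm{cop}$ of a connected graph is the least $k$ such that $k$ cops have a winning strategy; for a disconnected graph it is the maximum cop number of its connected components. -}

module Defs where

open import Data.Nat using (ℕ; _+_; _≤_; _<_)
open import Data.Fin using (Fin; toℕ)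
import Data.Fin as F
open import Data.Bool using (Bool; true; false)
open import Data.Product using (Σ; ∃; _×_; _,_; proj₁)
open import Data.Sum using (_⊎_; inj₁; inj₂)
open import Data.Empty using (⊥)
open import Relation.Nullary using (¬_)
open import Relation.Binary.PropositionalEquality using (_≡_)

record SimpleGraph (n : ℕ) : Set where
  field
    adj    : Fin n → Fin n → Bool
    sym    : ∀ u v → adj u v ≡ adj v u
    irrefl : ∀ v → adj v v ≡ false

record GameGraph : Set₁ where
  field
    V   : Set
    _~_ : V → V → Set

module Game (G : GameGraph) where
  open GameGraph G

  Step : V → V → Set
  Step x y = x ≡ y ⊎ x ~ y

  Captured : ∀ {k} → (Fin k → V) → V → Set
  Captured cs r = ∃ λ i → cs i ≡ r

  -- CopWin cs r : from the position with cops at cs, robber at r and the cops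
  -- to move, the cops can force a capture (in finitely many moves).
  data CopWin {k : ℕ} : (Fin k → V) → V → Set where
    caught : ∀ {cs r} → Captured cs r → CopWin cs r
    move   : ∀ {cs r} (cs' : Fin k → V) →
             (∀ i → Step (cs i) (cs' i)) →
             (Captured cs' r ⊎ (∀ r' → Step r r' → CopWin cs' r')) →
             CopWin cs r

  data Reach : V → V → Set where
    here  : ∀ {x} → Reach x x
    there : ∀ {x y z} → x ~ y → Reach y z → Reach x z

  KCopsWin : ℕ → Set
  KCopsWin k = ∀ c → Σ (Fin k → V) λ p →
                 (∀ i → Reach c (p i)) × (∀ r → Reach c r → CopWin p r)

  IsCopNumber : ℕ → Set
  IsCopNumber c = 1 ≤ c × KCopsWin c × (∀ k → 1 ≤ k → k < c → ¬ KCopsWin k)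

toGame : ∀ {n} → SimpleGraph n → GameGraph
toGame {n} G = record { V = Fin n ; _~_ = λ u v → SimpleGraph.adj G u v ≡ true }

-- edges {u,v} represented once, with u < v
Edge : ∀ {n} → SimpleGraph n → Set
Edge {n} G = Σ (Fin n × Fin n) λ uv →
  (proj₁ uv F.< Data.Product.proj₂ uv) × SimpleGraph.adj G (proj₁ uv) (Data.Product.proj₂ uv) ≡ true

-- Subdivision G_r: vertices are original vertices plus, for each edge {u,v}
-- (u < v), r internal vertices numbered 0..r-1 along the path u — 0 — … — (r-1) — v.
module Subdivision {n : ℕ} (G : SimpleGraph n) (r : ℕ) where
  SV : Set
  SV = Fin n ⊎ (Edge G × Fin r)

  EndAdj : Fin n → Edge G → Fin r → Set
  EndAdj a ((u , v) , _) i = (a ≡ u × toℕ i ≡ 0) ⊎ (a ≡ v × toℕ i + 1 ≡ r)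

  _~ₛ_ : SV → SV → Set
  inj₁ a ~ₛ inj₁ b = ⊥
  inj₁ a ~ₛ inj₂ (e , i) = EndAdj a e i
  inj₂ (e , i) ~ₛ inj₁ a = EndAdj a e i
  inj₂ (e , i) ~ₛ inj₂ (e' , j) =
    proj₁ e ≡ proj₁ e' × (toℕ i + 1 ≡ toℕ j ⊎ toℕ j + 1 ≡ toℕ i)

subdivide : ∀ {n} → SimpleGraph n → ℕ → GameGraph
subdivide G r = record { V = Subdivision.SV G r ; _~_ = Subdivision._~ₛ_ G r }

IsCopNumber : GameGraph → ℕ → Set
IsCopNumber G = Game.IsCopNumber G

-- A cop strategy on G_r is turned into one on G.  Each cop of G shadows a cop
-- of G_r, always moving to an end of the subdivided edge that cop stands on,
-- and each move of the robber in G is replayed in G_r as the r + 1 steps along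
-- the corresponding subdivided edge.  While the replayed robber crosses that
-- edge the cops of G stay put: if no cop of G can step onto the robber's target,
-- every cop of G_r is more than r + 1 away from it, so the replay cannot be
-- caught on the way; and after those r + 1 rounds each cop of G_r is still close
-- enough to its shadow for the shadow to follow it in one step.
module Submission where

open import Data.Nat using (ℕ; zero; suc; _+_; _∸_; _⊓_; _≤_; _<_; z≤n; s≤s; z<s; _≤?_)
open import Data.Nat.Properties
open import Data.Fin using (Fin; toℕ; fromℕ<)
import Data.Fin as Fin
import Data.Fin.Properties as Finₚ
open import Data.Vec.Functional using (updateAt)
open import Data.Vec.Functional.Properties using (updateAt-updates; updateAt-minimal)
open import Data.Bool using (true; false)
open import Data.Product using (_×_; _,_; proj₁; proj₂)
open import Data.Sum using (_⊎_; inj₁; inj₂; swap)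
open import Data.Empty using (⊥-elim)
open import Function using (_∘_; const)
open import Relation.Nullary using (¬_; Dec; yes; no)
open import Relation.Nullary.Decidable using (decidable-stable)
open import Relation.Binary using (tri<; tri≈; tri>)
open import Relation.Binary.PropositionalEquality

open import Defs

module _ {H : GameGraph} where
  open GameGraph H
  open Game H

  Reach-trans : ∀ {x y z} → Reach x y → Reach y z → Reach x z
  Reach-trans here        y↝z = y↝z
  Reach-trans (there e p) y↝z = there e (Reach-trans p y↝z)

  capture-next : ∀ {k} (cs : Fin k → V) {r} (i : Fin k) → Step (cs i) r → CopWin cs r
  capture-next cs {r} i step =
    move (updateAt cs i (const r)) moves (inj₁ (i , updateAt-updates i cs))
    where
    moves : ∀ j → Step (cs j) (updateAt cs i (const r) j)
    moves j with j Finₚ.≟ i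
    ... | yes refl = subst (Step (cs j)) (sym (updateAt-updates j cs)) step
    ... | no j≢i   = inj₁ (sym (updateAt-minimal j i cs j≢i))

⊓-≤-⊎ : ∀ {m n o} → m ⊓ n ≤ o → m ≤ o ⊎ n ≤ o
⊓-≤-⊎ {m} {n} m⊓n≤o with ⊓-sel m n
... | inj₁ m⊓n≡m = inj₁ (subst (_≤ _) m⊓n≡m m⊓n≤o)
... | inj₂ m⊓n≡n = inj₂ (subst (_≤ _) m⊓n≡n m⊓n≤o)

∸-suc-≤ : ∀ m i → m ∸ i ≤ suc (m ∸ suc i)
∸-suc-≤ zero    zero    = z≤n
∸-suc-≤ zero    (suc i) = z≤n
∸-suc-≤ (suc m) zero    = ≤-refl
∸-suc-≤ (suc m) (suc i) = ∸-suc-≤ m i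

+-≤-suc : ∀ m {i j} → i ≤ suc j → m + i ≤ suc (m + j)
+-≤-suc m {i} {j} i≤1+j = subst (m + i ≤_) (+-suc m j) (+-monoʳ-≤ m i≤1+j)

adjacent⇒≤suc : ∀ {i j} → i + 1 ≡ j ⊎ j + 1 ≡ i → i ≤ suc j
adjacent⇒≤suc {i} (inj₁ refl) = ≤-trans (m≤m+n i 1) (n≤1+n _)
adjacent⇒≤suc {j = j} (inj₂ refl) = ≤-reflexive (+-comm j 1)

module Subdivided {n : ℕ} (G : SimpleGraph n) (r : ℕ) where
  -- The number of inner vertices per edge, i.e. the r of the informal statement.
  R : ℕ
  R = suc r

  open SimpleGraph G using (adj; irrefl)
  open Subdivision G R
  module Base = Game (toGame G)
  module Sub  = Game (subdivide G R)

  0<R : 0 < R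
  0<R = z<s

  R≡1+i : ∀ {i} → i + 1 ≡ R → R ≡ suc i
  R≡1+i {i} i+1≡R = trans (sym i+1≡R) (+-comm i 1)

  adj-sym : ∀ {a b} → adj a b ≡ true → adj b a ≡ true
  adj-sym {a} {b} ab = trans (SimpleGraph.sym G b a) ab

  Step-sym : ∀ {a b} → Base.Step a b → Base.Step b a
  Step-sym (inj₁ a≡b) = inj₁ (sym a≡b)
  Step-sym (inj₂ ab)  = inj₂ (adj-sym ab)

  step? : ∀ a b → Dec (Base.Step a b)
  step? a b with a Finₚ.≟ b | adj a b
  ... | yes a≡b | _     = yes (inj₁ a≡b)
  ... | no _    | true  = yes (inj₂ refl)
  ... | no a≢b  | false = no λ { (inj₁ a≡b) → a≢b a≡b ; (inj₂ ()) }

  far : ℕ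
  far = suc (suc (R + R))

  -- The G_r-distance between branch vertices, truncated at far.
  branchDist : Fin n → Fin n → ℕ
  branchDist q u with u Finₚ.≟ q | adj q u
  ... | yes _ | _     = 0
  ... | no _  | true  = suc R
  ... | no _  | false = far

  branchDist-self : ∀ q → branchDist q q ≡ 0
  branchDist-self q with q Finₚ.≟ q
  ... | yes _  = refl
  ... | no q≢q = ⊥-elim (q≢q refl)

  branchDist≤far : ∀ q u → branchDist q u ≤ far
  branchDist≤far q u with u Finₚ.≟ q | adj q u
  ... | yes _ | _     = z≤n
  ... | no _  | true  = ≤-trans (n≤1+n (suc R)) (s≤s (s≤s (m≤n+m R R)))
  ... | no _  | false = ≤-refl

  branchDist-≢ : ∀ q u → u ≢ q → suc R ≤ branchDist q u
  branchDist-≢ q u u≢q with u Finₚ.≟ q | adj q u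
  ... | yes u≡q | _     = ⊥-elim (u≢q u≡q)
  ... | no _    | true  = ≤-refl
  ... | no _    | false = s≤s (≤-trans (m≤n+m R R) (n≤1+n _))

  branchDist-step : ∀ q u → Base.Step q u → branchDist q u ≤ suc R
  branchDist-step q u step with u Finₚ.≟ q | adj q u
  branchDist-step q u _            | yes _  | _     = z≤n
  branchDist-step q u _            | no _   | true  = ≤-refl
  branchDist-step q u (inj₁ q≡u)   | no u≢q | false = ⊥-elim (u≢q (sym q≡u))

  branchDist-¬step : ∀ q u → ¬ Base.Step q u → branchDist q u ≡ far
  branchDist-¬step q u ¬step with u Finₚ.≟ q | adj q u
  ... | yes u≡q | _     = ⊥-elim (¬step (inj₁ (sym u≡q)))
  ... | no _    | true  = ⊥-elim (¬step (inj₂ refl))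
  ... | no _    | false = refl

  branchDist-step⁻¹ : ∀ q u → branchDist q u ≤ suc (R + R) → Base.Step q u
  branchDist-step⁻¹ q u d<far with step? q u
  ... | yes step = step
  ... | no ¬step = ⊥-elim (<-irrefl (branchDist-¬step q u ¬step) (s≤s d<far))

  branchDist≤R⇒≡ : ∀ q u → branchDist q u ≤ R → u ≡ q
  branchDist≤R⇒≡ q u d≤R =
    decidable-stable (u Finₚ.≟ q) (λ u≢q → <⇒≱ (branchDist-≢ q u u≢q) d≤R)

  branchDist-adj : ∀ q {a b} → adj a b ≡ true → branchDist q a ≤ branchDist q b + suc R
  branchDist-adj q {a} {b} ab = by-cases (b Finₚ.≟ q)
    where
    open ≤-Reasoning
    by-cases : Dec (b ≡ q) → branchDist q a ≤ branchDist q b + suc R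
    by-cases (yes refl) = begin
      branchDist b a            ≤⟨ branchDist-step b a (inj₂ (adj-sym ab)) ⟩
      suc R                     ≡⟨ cong (_+ suc R) (branchDist-self b) ⟨
      branchDist b b + suc R    ∎
    by-cases (no b≢q) = begin
      branchDist q a            ≤⟨ branchDist≤far q a ⟩
      far                       ≡⟨ cong suc (+-suc R R) ⟨
      suc R + suc R             ≤⟨ +-monoˡ-≤ (suc R) (branchDist-≢ q b b≢q) ⟩
      branchDist q b + suc R    ∎

  -- A lower bound for the G_r-distance from the branch vertex q, exact on the
  -- subdivided edges at q.
  dist : Fin n → SV → ℕ
  dist q (inj₁ u)                   = branchDist q u
  dist q (inj₂ (((a , b) , _) , i)) = (branchDist q a + suc (toℕ i)) ⊓ (branchDist q b + (R ∸ toℕ i))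

  dist-edge : ∀ q {x y} → x ~ₛ y → dist q x ≤ suc (dist q y)
  dist-edge q {inj₁ _} {inj₂ (((a , b) , _ , ab) , i)} (inj₁ (refl , i≡0)) rewrite i≡0 =
    ⊓-glb (≤-trans (m≤m+n _ 1) (n≤1+n _))
          (subst (branchDist q a ≤_) (+-suc (branchDist q b) R) (branchDist-adj q ab))
  dist-edge q {inj₁ _} {inj₂ (((a , b) , _ , ab) , i)} (inj₂ (refl , i+1≡R)) =
    ⊓-glb (begin
             branchDist q b                  ≤⟨ branchDist-adj q (adj-sym ab) ⟩
             branchDist q a + suc R          ≡⟨ cong (λ d → branchDist q a + suc d) (R≡1+i i+1≡R) ⟩
             branchDist q a + suc (suc (toℕ i)) ≡⟨ +-suc (branchDist q a) _ ⟩
             suc (branchDist q a + suc (toℕ i)) ∎)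
          (≤-trans (m≤m+n _ _) (n≤1+n _))
    where open ≤-Reasoning
  dist-edge q {inj₂ (((a , b) , _) , i)} {inj₁ _} (inj₁ (refl , i≡0)) rewrite i≡0 =
    m≤n⇒m⊓o≤n _ (≤-reflexive (+-comm (branchDist q a) 1))
  dist-edge q {inj₂ (((a , b) , _) , i)} {inj₁ _} (inj₂ (refl , i+1≡R)) =
    m≤n⇒o⊓m≤n _ (≤-reflexive (trans (cong (branchDist q b +_) R∸i≡1) (+-comm (branchDist q b) 1)))
    where
    R∸i≡1 : R ∸ toℕ i ≡ 1
    R∸i≡1 = trans (cong (_∸ toℕ i) (R≡1+i i+1≡R)) (m+n∸n≡m 1 (toℕ i))
  dist-edge q {inj₂ (((a , b) , _) , i)} {inj₂ (_ , j)} (refl , i~j) =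
    ⊓-mono-≤ (+-≤-suc (branchDist q a) (s≤s (adjacent⇒≤suc i~j)))
             (+-≤-suc (branchDist q b) (≤-trans (∸-suc-≤ R (toℕ i))
                                                (s≤s (∸-monoʳ-≤ R (adjacent⇒≤suc (swap i~j))))))

  ~ₛ-sym : ∀ {x y} → x ~ₛ y → y ~ₛ x
  ~ₛ-sym {inj₁ _} {inj₂ _} x~y = x~y
  ~ₛ-sym {inj₂ _} {inj₁ _} x~y = x~y
  ~ₛ-sym {inj₂ _} {inj₂ _} (e≡e′ , i~j) = sym e≡e′ , swap i~j

  dist-step : ∀ q {x y} → Sub.Step x y → dist q x ≤ suc (dist q y)
  dist-step q (inj₁ refl) = n≤1+n _
  dist-step q (inj₂ x~y)  = dist-edge q x~y

  dist-step˘ : ∀ q {x y} → Sub.Step x y → dist q y ≤ suc (dist q x)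
  dist-step˘ q (inj₁ refl) = n≤1+n _
  dist-step˘ q (inj₂ x~y)  = dist-edge q (~ₛ-sym x~y)

  data Walk (w : Fin n) : SV → ℕ → Set where
    []  : Walk w (inj₁ w) 0
    _∷_ : ∀ {y y′ m} → Sub.Step y y′ → Walk w y′ m → Walk w y (suc m)

  dist-walk : ∀ {w y m} → Walk w y m → dist w y ≤ m
  dist-walk {w} []      = ≤-reflexive (branchDist-self w)
  dist-walk {w} (s ∷ W) = ≤-trans (dist-step w s) (s≤s (dist-walk W))

  walk-avoids : ∀ {w x y m} → Walk w y m → suc m ≤ dist w x → x ≢ y
  walk-avoids W m<d refl = <⇒≱ m<d (dist-walk W)

  walk-reach : ∀ {w y m} → Walk w y m → Sub.Reach y (inj₁ w)
  walk-reach []               = Sub.here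
  walk-reach (inj₁ refl ∷ W)  = walk-reach W
  walk-reach (inj₂ y~y′ ∷ W)  = Sub.there y~y′ (walk-reach W)

  inner : Edge G → ∀ {j} → j < R → SV
  inner e j<R = inj₂ (e , fromℕ< j<R)

  inner-adj : ∀ e {j} (j<R : j < R) (1+j<R : suc j < R) →
              inner e j<R ~ₛ inner e 1+j<R
  inner-adj e {j} j<R 1+j<R =
    refl , inj₁ (trans (cong (_+ 1) (Finₚ.toℕ-fromℕ< j<R))
                       (trans (+-comm j 1) (sym (Finₚ.toℕ-fromℕ< 1+j<R))))

  walk-down : ∀ {a b} (ab : (a Fin.< b) × adj a b ≡ true) {j} (j<R : j < R) →
              Walk a (inner ((a , b) , ab) j<R) (suc j)
  walk-down ab {zero}  0<R   = inj₂ (inj₁ (refl , Finₚ.toℕ-fromℕ< 0<R)) ∷ []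
  walk-down {a} {b} ab {suc j} 1+j<R =
    inj₂ (~ₛ-sym {inner e j<R} {inner e 1+j<R} (inner-adj e j<R 1+j<R)) ∷ walk-down ab j<R
    where
    e : Edge G
    e = ((a , b) , ab)
    j<R : j < R
    j<R = <-trans (n<1+n j) 1+j<R

  walk-up : ∀ {a b} (ab : (a Fin.< b) × adj a b ≡ true) {j} k (j<R : j < R) →
            j + suc k ≡ R → Walk b (inner ((a , b) , ab) j<R) (suc k)
  walk-up ab zero j<R j+1≡R =
    inj₂ (inj₂ (refl , trans (cong (_+ 1) (Finₚ.toℕ-fromℕ< j<R)) j+1≡R)) ∷ []
  walk-up {a} {b} ab {j} (suc k) j<R j+2+k≡R =
    inj₂ (inner-adj ((a , b) , ab) j<R 1+j<R) ∷ walk-up ab k 1+j<R 1+j+1+k≡R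
    where
    1+j+1+k≡R : suc j + suc k ≡ R
    1+j+1+k≡R = trans (sym (+-suc j (suc k))) j+2+k≡R
    1+j<R : suc j < R
    1+j<R = m+n≤o⇒m≤o (suc (suc j)) (≤-reflexive (trans (sym (+-suc (suc j) k)) 1+j+1+k≡R))

  edge-walk : ∀ {v w} → adj v w ≡ true → Walk w (inj₁ v) (suc R)
  edge-walk {v} {w} vw with Finₚ.<-cmp v w
  ... | tri< v<w _ _ = inj₂ (inj₁ (refl , Finₚ.toℕ-fromℕ< 0<R)) ∷ walk-up (v<w , vw) r 0<R refl
  ... | tri≈ _ refl _ with () ← trans (sym (irrefl v)) vw
  ... | tri> _ _ w<v =
    inj₂ (inj₂ (refl , trans (cong (_+ 1) (Finₚ.toℕ-fromℕ< (n<1+n r))) (+-comm r 1)))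
      ∷ walk-down (w<v , adj-sym vw) (n<1+n r)

  reach-lift : ∀ {u v} → Base.Reach u v → Sub.Reach (inj₁ u) (inj₁ v)
  reach-lift Base.here           = Sub.here
  reach-lift (Base.there uw w↝v) = Reach-trans (walk-reach (edge-walk uw)) (reach-lift w↝v)

  anchor : SV → Fin n
  anchor (inj₁ u)                   = u
  anchor (inj₂ (((a , _) , _) , _)) = a

  anchor-edge : ∀ {x y} → x ~ₛ y → Base.Reach (anchor x) (anchor y)
  anchor-edge {inj₁ _} {inj₂ _} (inj₁ (refl , _)) = Base.here
  anchor-edge {inj₁ _} {inj₂ (((_ , _) , _ , ab) , _)} (inj₂ (refl , _)) = Base.there (adj-sym ab) Base.here
  anchor-edge {inj₂ _} {inj₁ _} (inj₁ (refl , _)) = Base.here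
  anchor-edge {inj₂ (((_ , _) , _ , ab) , _)} {inj₁ _} (inj₂ (refl , _)) = Base.there ab Base.here
  anchor-edge {inj₂ _} {inj₂ _} (refl , _) = Base.here

  reach-anchor : ∀ {x y} → Sub.Reach x y → Base.Reach (anchor x) (anchor y)
  reach-anchor Sub.here          = Base.here
  reach-anchor (Sub.there x~y p) = Reach-trans (anchor-edge x~y) (reach-anchor p)

  dist-anchor : ∀ x → dist (anchor x) x ≤ R
  dist-anchor (inj₁ u) = ≤-trans (≤-reflexive (branchDist-self u)) z≤n
  dist-anchor (inj₂ (((a , _) , _) , i)) =
    m≤n⇒m⊓o≤n _ (subst (λ d → d + suc (toℕ i) ≤ R) (sym (branchDist-self a)) (Finₚ.toℕ<n i))

  shadow : Fin n → SV → Fin n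
  shadow q (inj₁ u) = u
  shadow q (inj₂ (((a , b) , _) , _)) with step? q a
  ... | yes _ = a
  ... | no _  = b

  shadow-near : ∀ q x → dist q x ≤ suc (R + R) → Base.Step q (shadow q x) × dist (shadow q x) x ≤ R
  shadow-near q x@(inj₁ u) d = branchDist-step⁻¹ q u d , dist-anchor x
  shadow-near q x@(inj₂ (((a , b) , _) , i)) d with step? q a
  ... | yes qa = qa , dist-anchor x
  ... | no ¬qa with ⊓-≤-⊎ d
  ...   | inj₁ via-a = ⊥-elim (¬qa (branchDist-step⁻¹ q a (m+n≤o⇒m≤o _ via-a)))
  ...   | inj₂ via-b =
    branchDist-step⁻¹ q b (m+n≤o⇒m≤o _ via-b) ,
    m≤n⇒o⊓m≤n _ (subst (λ d → d + (R ∸ toℕ i) ≤ R) (sym (branchDist-self b)) (m∸n≤m R (toℕ i)))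

  beyond-self : ∀ {s w} → ¬ Base.Step s w → suc (suc R) ≤ branchDist w s
  beyond-self {s} {w} ¬sw =
    subst (suc (suc R) ≤_) (sym (branchDist-¬step w s (¬sw ∘ Step-sym))) (s≤s (s≤s (m≤m+n R R)))

  beyond-neighbour : ∀ {s w c k} → ¬ Base.Step s w → adj s c ≡ true → 1 ≤ k →
                     suc (suc R) ≤ branchDist w c + k
  beyond-neighbour {s} {w} {c} {k} ¬sw sc 1≤k =
    subst (_≤ branchDist w c + k) (+-comm (suc R) 1)
          (+-mono-≤ (branchDist-≢ w c (λ { refl → ¬sw (inj₂ sc) })) 1≤k)

  dist-beyond : ∀ {s w} x → ¬ Base.Step s w → dist s x ≤ R → suc (suc R) ≤ dist w x
  dist-beyond {s} (inj₁ u) ¬sw d with branchDist≤R⇒≡ s u d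
  ... | refl = beyond-self ¬sw
  dist-beyond {s} (inj₂ (((a , b) , _ , ab) , i)) ¬sw d with ⊓-≤-⊎ d
  ... | inj₁ via-a with branchDist≤R⇒≡ s a (m+n≤o⇒m≤o _ via-a)
  ...   | refl = ⊓-glb (≤-trans (beyond-self ¬sw) (m≤m+n _ _))
                     (beyond-neighbour ¬sw ab (m<n⇒0<n∸m (Finₚ.toℕ<n i)))
  dist-beyond {s} (inj₂ (((a , b) , _ , ab) , i)) ¬sw d
      | inj₂ via-b with branchDist≤R⇒≡ s b (m+n≤o⇒m≤o _ via-b)
  ...   | refl = ⊓-glb (beyond-neighbour ¬sw (adj-sym ab) z<s)
                     (≤-trans (beyond-self ¬sw) (m≤m+n _ _))

  mutual
    simulate : ∀ {k} (Q : Fin k → Fin n) (P : Fin k → SV) v → (∀ l → dist (Q l) (P l) ≤ R + R) →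
               Sub.CopWin P (inj₁ v) → Base.CopWin Q v
    simulate Q P v near (Sub.caught (l , Pl≡v)) =
      capture-next Q l (subst (Base.Step (Q l) ∘ shadow (Q l)) Pl≡v
                              (proj₁ (shadow-near (Q l) (P l) (≤-trans (near l) (n≤1+n _)))))
    simulate {k} Q P v near (Sub.move P′ moves outcome) = Base.move Q′ (proj₁ ∘ shadows) (respond outcome)
      where
      Q′ : Fin k → Fin n
      Q′ l = shadow (Q l) (P′ l)
      shadows : ∀ l → Base.Step (Q l) (Q′ l) × dist (Q′ l) (P′ l) ≤ R
      shadows l = shadow-near (Q l) (P′ l) (≤-trans (dist-step˘ (Q l) (moves l)) (s≤s (near l)))
      respond : Sub.Captured P′ (inj₁ v) ⊎ (∀ y → Sub.Step (inj₁ v) y → Sub.CopWin P′ y) →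
                Base.Captured Q′ v ⊎ (∀ w → Base.Step v w → Base.CopWin Q′ w)
      respond (inj₁ (l , P′l≡v)) = inj₁ (l , cong (shadow (Q l)) P′l≡v)
      respond (inj₂ robber)      = inj₂ (after-robber Q′ P′ v (proj₂ ∘ shadows) robber)

    after-robber : ∀ {k} (Q : Fin k → Fin n) (P : Fin k → SV) v → (∀ l → dist (Q l) (P l) ≤ R) →
                   (∀ y → Sub.Step (inj₁ v) y → Sub.CopWin P y) → ∀ w → Base.Step v w → Base.CopWin Q w
    after-robber Q P v close robber v (inj₁ refl) =
      simulate Q P v (λ l → ≤-trans (close l) (m≤m+n R R)) (robber (inj₁ v) (inj₁ refl))
    after-robber Q P v close robber w (inj₂ vw) with Finₚ.any? (λ l → step? (Q l) w) | edge-walk vw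
    ... | yes (l , Ql→w) | _      = capture-next Q l Ql→w
    ... | no ¬Q→w        | s ∷ W  =
      cross-edge Q w P W (λ l → dist-beyond (P l) (λ Ql→w → ¬Q→w (l , Ql→w)) (close l))
                         (λ l → +-monoˡ-≤ R (close l)) (robber _ s)

    -- The cops of G wait at Q while the replayed robber walks W to w.
    cross-edge : ∀ {k} (Q : Fin k → Fin n) w (P : Fin k → SV) {y m} → Walk w y m →
                 (∀ l → suc (suc m) ≤ dist w (P l)) → (∀ l → dist (Q l) (P l) + m ≤ R + R) →
                 Sub.CopWin P y → Base.CopWin Q w
    cross-edge Q w P [] _ near T = simulate Q P w (λ l → subst (_≤ R + R) (+-identityʳ _) (near l)) T
    cross-edge Q w P W@(_ ∷ _) far _ (Sub.caught (l , Pl≡y)) =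
      ⊥-elim (walk-avoids W (≤-trans (n≤1+n _) (far l)) Pl≡y)
    cross-edge Q w P {m = suc m} W@(s ∷ W′) far near (Sub.move P′ moves outcome) = continue outcome
      where
      far′ : ∀ l → suc (suc m) ≤ dist w (P′ l)
      far′ l = ≤-pred (≤-trans (far l) (dist-step w (moves l)))
      near′ : ∀ l → dist (Q l) (P′ l) + m ≤ R + R
      near′ l = ≤-trans (+-monoˡ-≤ m (dist-step˘ (Q l) (moves l)))
                        (subst (_≤ R + R) (+-suc _ m) (near l))
      continue : Sub.Captured P′ _ ⊎ (∀ y′ → Sub.Step _ y′ → Sub.CopWin P′ y′) → Base.CopWin Q w
      continue (inj₁ (l , P′l≡y)) = ⊥-elim (walk-avoids W (far′ l) P′l≡y)
      continue (inj₂ robber)      = cross-edge Q w P′ W′ far′ near′ (robber _ s)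

  kCopsWin-descends : ∀ k → Sub.KCopsWin k → Base.KCopsWin k
  kCopsWin-descends k win c with win (inj₁ c)
  ... | P , P-reach , P-wins =
    anchor ∘ P , reach-anchor ∘ P-reach ,
    λ v c↝v → simulate (anchor ∘ P) P v (λ l → ≤-trans (dist-anchor (P l)) (m≤m+n R R))
                       (P-wins (inj₁ v) (reach-lift c↝v))

corollary12 : (n : ℕ) (G : SimpleGraph n) (r : ℕ) → 1 ≤ r →
    (c c' : ℕ) → IsCopNumber (toGame G) c → IsCopNumber (subdivide G r) c' →
    c ≤ c'
corollary12 n G (suc r) _ c c' (_ , _ , c-least) (1≤c' , c'-wins , _) =
  decidable-stable (c ≤? c')
    (λ c≰c' → c-least c' 1≤c' (≰⇒> c≰c') (Subdivided.kCopsWin-descends G r c' c'-wins))
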